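{- Let $n\ge 1$ and let $S=(s_i)$ be an orientable sequence of order $n$ and period $m$. Then: (i) if $w(S)$ is even, $D^{ -1}(S)$ consists of an o-disjoint pair of primitive, mutually complementary orientable sequences of order $n+1$, each of period $m$; (ii) if $w(S)$ is odd, $D^{ -1}(S)$ consists of two different shifts of a single orientable sequence of order $n+1$, of period $2m$ and weight $m$.
   Context: A periodic binary sequence $S=(s_i)$, $s_i\in\{0,1\}$, has period $m$ = least $m>0$ with $s_{i+m}=s_i$ for all $i$. For $n>0$, $\mathbf{s}_n(i)=(s_i,\dots,s_{i+n-1})$ is the $n$-tuple at position $i$. The weight is $w(S)=\sum_{i=0}^{m-1}s_i$. The reverse of a tuple $(u_0,\dots,u_{n-1})$ is $(u_{n-1},\dots,u_0)$, written $\mathbf{u}^R$. The complement of a tuple/sequence swaps every $0$ and $1$. An $n$-window sequence is a periodic binary sequence of period $m$ such that $\mathbf{s}_n(i)=\mathbf{s}_n(j)$ implies $i\equiv j \pmod m$. An orientable sequence of order $n$ is an $n$-window sequence with $\mathbf{s}_n(i)\neq \mathbf{s}_n(j)^R$ for all $i,j$. Two $n$-window sequences $S,T$ are disjoint if $\mathbf{s}_n(i)\ne\mathbf{t}_n(j)$ for all $i,j$; a pair of disjoint orientable sequences $S,S'$ of order $n$ is o-disjoint if additionally $\mathbf{s}_n(i)\neq \mathbf{s}'_n(j)^R$ for all $i,j$. An $n$-window sequence is primitive if it is disjoint from its complement. The Lempel map $D$ sends a periodic binary sequence $T=(t_i)$ to $D(T)=(t_i\oplus t_{i+1})$ ($\oplus$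 = addition mod 2); $D^{ -1}(S)$ is the set of all periodic binary sequences $T$ with $D(T)=S$. -}

module Defs where

open import Data.Bool using (Bool; true; false; not; _xor_)
open import Data.Nat using (ℕ; zero; suc; _+_; _*_; _<_)
open import Data.Sum using (_⊎_)
open import Data.Fin using (Fin; toℕ)
open import Data.Vec using (Vec; tabulate; reverse)
open import Data.Product using (_×_; ∃)
open import Relation.Nullary using (¬_)
open import Relation.Binary.PropositionalEquality using (_≡_; _≢_)

-- A binary sequence indexed by ℕ (periodic sequences are determined by
-- their values on ℕ).
Seq : Set
Seq = ℕ → Bool

_≈_ : Seq → Seq → Set
s ≈ t = ∀ i → s i ≡ t i

IsPeriod : ℕ → Seq → Set
IsPeriod m s = (0 < m) × (∀ i → s (i + m) ≡ s i)

HasPeriod : ℕ → Seq → Set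
HasPeriod m s = IsPeriod m s × (∀ k → 0 < k → k < m → ¬ IsPeriod k s)

Periodic : Seq → Set
Periodic s = ∃ λ m → IsPeriod m s

window : (n : ℕ) → Seq → ℕ → Vec Bool n
window n s i = tabulate (λ j → s (i + toℕ j))

bit : Bool → ℕ
bit true  = 1
bit false = 0

weight : ℕ → Seq → ℕ
weight zero    s = 0
weight (suc m) s = weight m s + bit (s m)

complement : Seq → Seq
complement s i = not (s i)

shift : ℕ → Seq → Seq
shift k s i = s (k + i)

CongMod : ℕ → ℕ → ℕ → Set
CongMod m i j = ∃ λ k → (i ≡ j + k * m) ⊎ (j ≡ i + k * m)

NWindow : ℕ → ℕ → Seq → Set
NWindow n m s = HasPeriod m s ×
  (∀ i j → window n s i ≡ window n s j → CongMod m i j)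

Orientable : ℕ → ℕ → Seq → Set
Orientable n m s = NWindow n m s ×
  (∀ i j → window n s i ≢ reverse (window n s j))

Disjoint : ℕ → Seq → Seq → Set
Disjoint n s t = ∀ i j → window n s i ≢ window n t j

ODisjoint : ℕ → Seq → Seq → Set
ODisjoint n s t = Disjoint n s t × (∀ i j → window n s i ≢ reverse (window n t j))

Primitive : ℕ → ℕ → Seq → Set
Primitive n m s = NWindow n m s × Disjoint n s (complement s)

D : Seq → Seq
D t i = t i xor t (suc i)

InDInv : Seq → Seq → Set
InDInv s t = Periodic t × (D t ≈ s)

{-# OPTIONS --safe #-}
-- D is two-to-one: its fibre over s is {T, complement T}, where T is the running
-- xor of s started at 0. The (n+1)-windows of a lift map under D onto the n-windows of s, and this
-- commutes with reversal, so a repeated or reversed window of a lift yields one of s; hence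
-- coincidences of lift windows only occur at positions congruent mod m. Periodicity of s gives
-- T (i + m) = T m xor T i, and T m is the parity of w(S). If it is even, T and its complement
-- have period m and form the pair of (i). If it is odd, T is m-antiperiodic: it has period 2m,
-- its complement is its shift by m, its two half-periods are complementary (so w = m), and
-- positions congruent mod m with equal bits are congruent mod 2m, which gives (ii).
module Submission where

open import Defs
open import Data.Nat using (ℕ; zero; suc; _+_; _*_; _%_; _<_; _≤_; z≤n; s≤s)
open import Data.Nat.Properties using (+-identityʳ; +-suc; +-comm; +-assoc; m+n≡0⇒m≡0; m+n≮m; n≮n)
open import Data.Nat.DivMod using (%-distribˡ-+)
open import Data.Nat.Solver using (module +-*-Solver)
open import Data.Bool using (Bool; true; false; not; _xor_)
open import Data.Bool.Properties using (xor-assoc; xor-comm; xor-same; not-involutive; not-¬)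
open import Data.Fin using (toℕ)
open import Data.Vec using (Vec; []; _∷_; _∷ʳ_; head; tail; init; zipWith; reverse)
open import Data.Vec.Properties
  using (tabulate-cong; reverse-∷; init-reverse; reverse-involutive; reverse-reverse; zipWith-comm)
open import Data.Product using (_×_; Σ; ∃; _,_; proj₁; proj₂)
open import Data.Sum using (_⊎_; inj₁; inj₂; map₂)
open import Data.Empty using (⊥-elim)
open import Relation.Nullary using (¬_)
open import Relation.Binary.PropositionalEquality
  using (_≡_; _≢_; refl; sym; trans; cong; cong₂; module ≡-Reasoning)

open +-*-Solver using (solve; _:=_; _:+_; con)
open ≡-Reasoning

private
  variable
    A B C : Set
    k n : ℕ

xor-cancelˡ : ∀ a b → a xor (a xor b) ≡ b
xor-cancelˡ a b = trans (sym (xor-assoc a a b)) (cong (_xor b) (xor-same a))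

not-xor-not : ∀ a b → not a xor not b ≡ a xor b
not-xor-not false b = not-involutive b
not-xor-not true  b = refl

bit-xor : ∀ a b → bit (a xor b) ≡ (bit a + bit b) % 2
bit-xor false false = refl
bit-xor false true  = refl
bit-xor true  false = refl
bit-xor true  true  = refl

bit%2 : ∀ b → bit b % 2 ≡ bit b
bit%2 false = refl
bit%2 true  = refl

bit≡0 : ∀ {b} → bit b ≡ 0 → b ≡ false
bit≡0 {false} _ = refl

bit≡1 : ∀ {b} → bit b ≡ 1 → b ≡ true
bit≡1 {true} _ = refl

bit+bit-not : ∀ b → bit b + bit (not b) ≡ 1
bit+bit-not false = refl
bit+bit-not true  = refl

zipWith-∷ʳ : ∀ (f : A → B → C) (xs : Vec A n) (ys : Vec B n) x y →
             zipWith f (xs ∷ʳ x) (ys ∷ʳ y) ≡ zipWith f xs ys ∷ʳ f x y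
zipWith-∷ʳ f []        []        x y = refl
zipWith-∷ʳ f (x′ ∷ xs) (y′ ∷ ys) x y = cong (f x′ y′ ∷_) (zipWith-∷ʳ f xs ys x y)

reverse-zipWith : ∀ (f : A → B → C) (xs : Vec A n) (ys : Vec B n) →
                  reverse (zipWith f xs ys) ≡ zipWith f (reverse xs) (reverse ys)
reverse-zipWith f []       []       = refl
reverse-zipWith f (x ∷ xs) (y ∷ ys) = begin
  reverse (f x y ∷ zipWith f xs ys)               ≡⟨ reverse-∷ (f x y) (zipWith f xs ys) ⟩
  reverse (zipWith f xs ys) ∷ʳ f x y              ≡⟨ cong (_∷ʳ f x y) (reverse-zipWith f xs ys) ⟩
  zipWith f (reverse xs) (reverse ys) ∷ʳ f x y    ≡⟨ zipWith-∷ʳ f (reverse xs) (reverse ys) x y ⟨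
  zipWith f (reverse xs ∷ʳ x) (reverse ys ∷ʳ y)   ≡⟨ cong₂ (zipWith f) (reverse-∷ x xs) (reverse-∷ y ys) ⟨
  zipWith f (reverse (x ∷ xs)) (reverse (y ∷ ys)) ∎

tail-reverse : ∀ (xs : Vec A (suc n)) → tail (reverse xs) ≡ reverse (init xs)
tail-reverse xs = sym (reverse-reverse
  (trans (sym (init-reverse (reverse xs))) (cong init (reverse-involutive xs))))

Dᵥ : Vec Bool (suc n) → Vec Bool n
Dᵥ v = zipWith _xor_ (init v) (tail v)

Dᵥ-reverse : ∀ (v : Vec Bool (suc n)) → Dᵥ (reverse v) ≡ reverse (Dᵥ v)
Dᵥ-reverse v = begin
  zipWith _xor_ (init (reverse v)) (tail (reverse v)) ≡⟨ cong₂ (zipWith _xor_) (init-reverse v) (tail-reverse v) ⟩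
  zipWith _xor_ (reverse (tail v)) (reverse (init v)) ≡⟨ reverse-zipWith _xor_ (tail v) (init v) ⟨
  reverse (zipWith _xor_ (tail v) (init v))           ≡⟨ cong reverse (zipWith-comm xor-comm (tail v) (init v)) ⟩
  reverse (Dᵥ v)                                      ∎

window-cong : ∀ n {f g} → f ≈ g → ∀ i → window n f i ≡ window n g i
window-cong n f≈g i = tabulate-cong (λ x → f≈g (i + toℕ x))

window-suc : ∀ n f i → window (suc n) f i ≡ f i ∷ window n f (suc i)
window-suc n f i = cong₂ _∷_ (cong f (+-identityʳ i)) (tabulate-cong (λ x → cong f (+-suc i (toℕ x))))

window-head : ∀ f g {i j} → window (suc n) f i ≡ window (suc n) g j → f i ≡ g j
window-head {n} f g {i} {j} eq = begin
  f i                       ≡⟨ cong head (window-suc n f i) ⟨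
  head (window (suc n) f i) ≡⟨ cong head eq ⟩
  head (window (suc n) g j) ≡⟨ cong head (window-suc n g j) ⟩
  g j                       ∎

init-window : ∀ n f i → init (window (suc n) f i) ≡ window n f i
init-window zero    f i = refl
init-window (suc n) f i = begin
  init (window (suc (suc n)) f i)      ≡⟨ cong init (window-suc (suc n) f i) ⟩
  f i ∷ init (window (suc n) f (suc i)) ≡⟨ cong (f i ∷_) (init-window n f (suc i)) ⟩
  f i ∷ window n f (suc i)             ≡⟨ window-suc n f i ⟨
  window (suc n) f i                   ∎

window-periodic : ∀ n {f} → (∀ i → f (i + k) ≡ f i) → window n f k ≡ window n f 0
window-periodic {k} n {f} per = tabulate-cong (λ x → trans (cong f (+-comm k (toℕ x))) (per (toℕ x)))

window-D-zipWith : ∀ n f i → window n (D f) i ≡ zipWith _xor_ (window n f i) (window n f (suc i))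
window-D-zipWith zero    f i = refl
window-D-zipWith (suc n) f i = begin
  window (suc n) (D f) i
    ≡⟨ window-suc n (D f) i ⟩
  D f i ∷ window n (D f) (suc i)
    ≡⟨ cong (D f i ∷_) (window-D-zipWith n f (suc i)) ⟩
  D f i ∷ zipWith _xor_ (window n f (suc i)) (window n f (suc (suc i)))
    ≡⟨ cong₂ (zipWith _xor_) (window-suc n f i) (window-suc n f (suc i)) ⟨
  zipWith _xor_ (window (suc n) f i) (window (suc n) f (suc i))
    ∎

window-D : ∀ n f i → window n (D f) i ≡ Dᵥ (window (suc n) f i)
window-D n f i = trans (window-D-zipWith n f i)
  (sym (cong₂ (zipWith _xor_) (init-window n f i) (cong tail (window-suc n f i))))

D-window : ∀ f g {i j} → window (suc n) f i ≡ window (suc n) g j →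
           window n (D f) i ≡ window n (D g) j
D-window {n} f g {i} {j} eq = begin
  window n (D f) i          ≡⟨ window-D n f i ⟩
  Dᵥ (window (suc n) f i)   ≡⟨ cong Dᵥ eq ⟩
  Dᵥ (window (suc n) g j)   ≡⟨ window-D n g j ⟨
  window n (D g) j          ∎

D-window-reverse : ∀ f g {i j} → window (suc n) f i ≡ reverse (window (suc n) g j) →
                   window n (D f) i ≡ reverse (window n (D g) j)
D-window-reverse {n} f g {i} {j} eq = begin
  window n (D f) i                  ≡⟨ window-D n f i ⟩
  Dᵥ (window (suc n) f i)           ≡⟨ cong Dᵥ eq ⟩
  Dᵥ (reverse (window (suc n) g j)) ≡⟨ Dᵥ-reverse (window (suc n) g j) ⟩
  reverse (Dᵥ (window (suc n) g j)) ≡⟨ cong reverse (window-D n g j) ⟨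
  reverse (window n (D g) j)        ∎

D-cong : ∀ {f g} → f ≈ g → D f ≈ D g
D-cong f≈g i = cong₂ _xor_ (f≈g i) (f≈g (suc i))

D-complement : ∀ f → D (complement f) ≈ D f
D-complement f i = not-xor-not (f i) (f (suc i))

D-cancel : ∀ {f g} → D f ≈ D g → f 0 ≡ g 0 → f ≈ g
D-cancel Df≈Dg f0≡g0 zero    = f0≡g0
D-cancel {f} {g} Df≈Dg f0≡g0 (suc i) = begin
  f (suc i)           ≡⟨ xor-cancelˡ (f i) (f (suc i)) ⟨
  f i xor D f i       ≡⟨ cong₂ _xor_ (D-cancel {f} {g} Df≈Dg f0≡g0 i) (Df≈Dg i) ⟩
  g i xor D g i       ≡⟨ xor-cancelˡ (g i) (g (suc i)) ⟩
  g (suc i)           ∎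

integrate : Seq → Seq
integrate s zero    = false
integrate s (suc i) = integrate s i xor s i

D-integrate : ∀ s → D (integrate s) ≈ s
D-integrate s i = xor-cancelˡ (integrate s i) (s i)

D-complement-integrate : ∀ s → D (complement (integrate s)) ≈ s
D-complement-integrate s i = trans (D-complement (integrate s) i) (D-integrate s i)

integrate-fibre : ∀ {s u} → D u ≈ s → u ≈ integrate s ⊎ u ≈ complement (integrate s)
integrate-fibre {s} {u} Du with u 0 in u0
... | false = inj₁ (D-cancel (λ i → trans (Du i) (sym (D-integrate s i))) u0)
... | true  = inj₂ (D-cancel (λ i → trans (Du i) (sym (D-complement-integrate s i))) u0)

integrate-+ : ∀ {m} {s : Seq} → (∀ i → s (i + m) ≡ s i) →
              ∀ i → integrate s (i + m) ≡ integrate s m xor integrate s i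
integrate-+ per zero    = sym (xor-comm _ false)
integrate-+ {m} {s} per (suc i) = begin
  integrate s (i + m) xor s (i + m)                  ≡⟨ cong₂ _xor_ (integrate-+ per i) (per i) ⟩
  (integrate s m xor integrate s i) xor s i          ≡⟨ xor-assoc (integrate s m) (integrate s i) (s i) ⟩
  integrate s m xor (integrate s i xor s i)          ∎

bit-integrate : ∀ s m → bit (integrate s m) ≡ weight m s % 2
bit-integrate s zero    = refl
bit-integrate s (suc m) = begin
  bit (integrate s m xor s m)                    ≡⟨ bit-xor (integrate s m) (s m) ⟩
  (bit (integrate s m) + bit (s m)) % 2          ≡⟨ cong₂ (λ a b → (a + b) % 2) (bit-integrate s m) (sym (bit%2 (s m))) ⟩
  (weight m s % 2 + bit (s m) % 2) % 2           ≡⟨ %-distribˡ-+ (weight m s) (bit (s m)) 2 ⟨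
  (weight m s + bit (s m)) % 2                   ∎

AntiPeriodic : ℕ → Seq → Set
AntiPeriodic m t = ∀ i → t (i + m) ≡ not (t i)

integrate-periodic : ∀ {m s} → IsPeriod m s → weight m s % 2 ≡ 0 → IsPeriod m (integrate s)
integrate-periodic {m} {s} (m>0 , per) even =
  m>0 , λ i → trans (integrate-+ per i) (cong (_xor integrate s i) (bit≡0 (trans (bit-integrate s m) even)))

integrate-antiperiodic : ∀ {m s} → IsPeriod m s → weight m s % 2 ≡ 1 → AntiPeriodic m (integrate s)
integrate-antiperiodic {m} {s} (_ , per) odd i =
  trans (integrate-+ per i) (cong (_xor integrate s i) (bit≡1 (trans (bit-integrate s m) odd)))

complement-periodic : ∀ {p f} → IsPeriod p f → IsPeriod p (complement f)
complement-periodic (p>0 , per) = p>0 , λ i → cong not (per i)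

shift-periodic : ∀ {p f} a → IsPeriod p f → IsPeriod p (shift a f)
shift-periodic {p} {f} a (p>0 , per) = p>0 , λ i → trans (cong f (sym (+-assoc a i p))) (per (a + i))

periodic-multiple : ∀ {m} {f : Seq} → (∀ i → f (i + m) ≡ f i) → ∀ c j → f (j + c * m) ≡ f j
periodic-multiple {m} {f} per zero    j = cong f (+-identityʳ j)
periodic-multiple {m} {f} per (suc c) j = begin
  f (j + (m + c * m))  ≡⟨ cong f (trans (cong (j +_) (+-comm m (c * m))) (sym (+-assoc j (c * m) m))) ⟩
  f (j + c * m + m)    ≡⟨ per (j + c * m) ⟩
  f (j + c * m)        ≡⟨ periodic-multiple {f = f} per c j ⟩
  f j                  ∎

periodic-CongMod : ∀ {m i j} (f : Seq) → (∀ i → f (i + m) ≡ f i) → CongMod m i j → f i ≡ f j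
periodic-CongMod f per (c , inj₁ refl) = periodic-multiple {f = f} per c _
periodic-CongMod f per (c , inj₂ refl) = sym (periodic-multiple {f = f} per c _)

CongMod-zero : ∀ {m k} → CongMod m k 0 → ∃ λ c → k ≡ c * m
CongMod-zero (c , inj₁ k≡cm)  = c , k≡cm
CongMod-zero {k = k} (c , inj₂ 0≡k+cm) = 0 , m+n≡0⇒m≡0 k (sym 0≡k+cm)

least-period : ∀ {p f} → IsPeriod p f → (∀ k → IsPeriod k f → ∃ λ c → k ≡ c * p) → HasPeriod p f
least-period {p} {f} per multiple = per , excluded
  where
  excluded : ∀ k → 0 < k → k < p → ¬ IsPeriod k f
  excluded k 0<k k<p perₖ with multiple k perₖ
  ... | zero  , refl = n≮n 0 0<k
  ... | suc c , refl = m+n≮m p (c * p) k<p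

antiperiodic-twice : ∀ {m t} → AntiPeriodic m t → ∀ i → t (i + 2 * m) ≡ t i
antiperiodic-twice {m} {t} anti i = begin
  t (i + (m + (m + 0)))  ≡⟨ cong t (solve 2 (λ i m → i :+ (m :+ (m :+ con 0)) := (i :+ m) :+ m) refl i m) ⟩
  t (i + m + m)          ≡⟨ anti (i + m) ⟩
  not (t (i + m))        ≡⟨ cong not (anti i) ⟩
  not (not (t i))        ≡⟨ not-involutive (t i) ⟩
  t i                    ∎

antiperiodic⇒periodic : ∀ {m t} → 0 < m → AntiPeriodic m t → IsPeriod (2 * m) t
antiperiodic⇒periodic (s≤s _) anti = s≤s z≤n , antiperiodic-twice anti

antiperiodic-shift : ∀ {m t} → AntiPeriodic m t → shift m t ≈ complement t
antiperiodic-shift {m} {t} anti i = trans (cong t (+-comm m i)) (anti i)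

antiperiodic-even : ∀ {m t} → AntiPeriodic m t → ∀ c j → t (j + c * m) ≡ t j →
                    ∃ λ h → c * m ≡ h * (2 * m)
antiperiodic-even anti zero j _ = 0 , refl
antiperiodic-even {m} {t} anti (suc zero) j fixed =
  ⊥-elim (not-¬ refl (trans (sym fixed) (trans (cong (λ x → t (j + x)) (+-identityʳ m)) (anti j))))
antiperiodic-even {m} {t} anti (suc (suc c)) j fixed =
  let h , cm≡h2m = antiperiodic-even anti c j fixed′ in
  suc h , trans (cong (λ x → m + (m + x)) cm≡h2m)
                (solve 2 (λ m y → m :+ (m :+ y) := (m :+ (m :+ con 0)) :+ y) refl m (h * (2 * m)))
  where
  fixed′ : t (j + c * m) ≡ t j
  fixed′ = begin
    t (j + c * m)             ≡⟨ antiperiodic-twice anti (j + c * m) ⟨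
    t (j + c * m + 2 * m)     ≡⟨ cong t (solve 3 (λ j m x → (j :+ x) :+ (m :+ (m :+ con 0)) := j :+ (m :+ (m :+ x)))
                                                refl j m (c * m)) ⟩
    t (j + suc (suc c) * m)   ≡⟨ fixed ⟩
    t j                       ∎

antiperiodic-CongMod : ∀ {m t i j} → AntiPeriodic m t → CongMod m i j → t i ≡ t j → CongMod (2 * m) i j
antiperiodic-CongMod {j = j} anti (c , inj₁ refl) ti≡tj =
  let h , cm≡h2m = antiperiodic-even anti c j ti≡tj in h , inj₁ (cong (j +_) cm≡h2m)
antiperiodic-CongMod {i = i} anti (c , inj₂ refl) ti≡tj =
  let h , cm≡h2m = antiperiodic-even anti c i (sym ti≡tj) in h , inj₂ (cong (i +_) cm≡h2m)

weight-cong : ∀ m {f g} → f ≈ g → weight m f ≡ weight m g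
weight-cong zero    f≈g = refl
weight-cong (suc m) f≈g = cong₂ _+_ (weight-cong m f≈g) (cong bit (f≈g m))

weight-+ : ∀ a b f → weight (a + b) f ≡ weight a f + weight b (shift a f)
weight-+ a zero    f = trans (cong (λ x → weight x f) (+-identityʳ a)) (sym (+-identityʳ _))
weight-+ a (suc b) f = begin
  weight (a + suc b) f                                     ≡⟨ cong (λ x → weight x f) (+-suc a b) ⟩
  weight (a + b) f + bit (f (a + b))                       ≡⟨ cong (_+ bit (f (a + b))) (weight-+ a b f) ⟩
  weight a f + weight b (shift a f) + bit (f (a + b))      ≡⟨ +-assoc (weight a f) _ _ ⟩
  weight a f + (weight b (shift a f) + bit (f (a + b)))    ∎

weight-complement : ∀ m f → weight m f + weight m (complement f) ≡ m
weight-complement zero    f = refl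
weight-complement (suc m) f = begin
  (weight m f + bit (f m)) + (weight m (complement f) + bit (not (f m)))
    ≡⟨ solve 4 (λ a x b y → (a :+ x) :+ (b :+ y) := (x :+ y) :+ (a :+ b)) refl
         (weight m f) (bit (f m)) (weight m (complement f)) (bit (not (f m))) ⟩
  (bit (f m) + bit (not (f m))) + (weight m f + weight m (complement f))
    ≡⟨ cong₂ _+_ (bit+bit-not (f m)) (weight-complement m f) ⟩
  suc m
    ∎

weight-antiperiodic : ∀ {m t} → AntiPeriodic m t → weight (2 * m) t ≡ m
weight-antiperiodic {m} {t} anti = begin
  weight (m + (m + 0)) t                   ≡⟨ cong (λ x → weight (m + x) t) (+-identityʳ m) ⟩
  weight (m + m) t                         ≡⟨ weight-+ m m t ⟩
  weight m t + weight m (shift m t)        ≡⟨ cong (weight m t +_) (weight-cong m (antiperiodic-shift anti)) ⟩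
  weight m t + weight m (complement t)     ≡⟨ weight-complement m t ⟩
  m                                        ∎

module Lift {n m : ℕ} {s : Seq} (orient : Orientable n m s) where

  private
    s-period : IsPeriod m s
    s-period = proj₁ (proj₁ (proj₁ orient))

    s-window : ∀ i j → window n s i ≡ window n s j → CongMod m i j
    s-window = proj₂ (proj₁ orient)

    s-reverse : ∀ i j → window n s i ≢ reverse (window n s j)
    s-reverse = proj₂ orient

  lift-window : ∀ f g {i j} → D f ≈ s → D g ≈ s →
                window (suc n) f i ≡ window (suc n) g j → CongMod m i j
  lift-window f g {i} {j} Df Dg eq = s-window i j (begin
    window n s i      ≡⟨ window-cong n (λ x → sym (Df x)) i ⟩
    window n (D f) i  ≡⟨ D-window f g eq ⟩
    window n (D g) j  ≡⟨ window-cong n Dg j ⟩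
    window n s j      ∎)

  lift-reverse : ∀ f g i j → D f ≈ s → D g ≈ s →
                 window (suc n) f i ≢ reverse (window (suc n) g j)
  lift-reverse f g i j Df Dg eq = s-reverse i j (begin
    window n s i                ≡⟨ window-cong n (λ x → sym (Df x)) i ⟩
    window n (D f) i            ≡⟨ D-window-reverse f g eq ⟩
    reverse (window n (D g) j)  ≡⟨ cong reverse (window-cong n Dg j) ⟩
    reverse (window n s j)      ∎)

  lift-period : ∀ f {k} → D f ≈ s → IsPeriod k f → CongMod m k 0
  lift-period f Df (_ , per) = lift-window f f Df Df (window-periodic (suc n) per)

  periodic-lift-orientable : ∀ f → D f ≈ s → IsPeriod m f → Orientable (suc n) m f
  periodic-lift-orientable f Df per =
    (least-period per (λ k perₖ → CongMod-zero (lift-period f Df perₖ)) , λ i j → lift-window f f Df Df) ,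
    λ i j → lift-reverse f f i j Df Df

  -- Equal windows of f and its complement would force f i ≡ f j and f i ≡ not (f j).
  periodic-lift-disjoint : ∀ f → D f ≈ s → IsPeriod m f → Disjoint (suc n) f (complement f)
  periodic-lift-disjoint f Df (_ , per) i j eq =
    not-¬ (periodic-CongMod f per (lift-window f (complement f) Df (λ x → trans (D-complement f x) (Df x)) eq))
      (window-head f (complement f) eq)

  periodic-lift-primitive : ∀ f → D f ≈ s → IsPeriod m f → Primitive (suc n) m f
  periodic-lift-primitive f Df per = proj₁ (periodic-lift-orientable f Df per) , periodic-lift-disjoint f Df per

  antiperiodic-lift-orientable : ∀ t → D t ≈ s → AntiPeriodic m t → Orientable (suc n) (2 * m) t
  antiperiodic-lift-orientable t Dt anti =
    (least-period (antiperiodic⇒periodic (proj₁ s-period) anti) periods ,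
     λ i j eq → antiperiodic-CongMod anti (lift-window t t Dt Dt eq) (window-head t t eq)) ,
    λ i j → lift-reverse t t i j Dt Dt
    where
    periods : ∀ k → IsPeriod k t → ∃ λ c → k ≡ c * (2 * m)
    periods k perₖ = CongMod-zero (antiperiodic-CongMod anti (lift-period t Dt perₖ) (proj₂ perₖ 0))

theorem4 : (n m : ℕ) → 1 ≤ n → (s : Seq) → Orientable n m s →
    ((weight m s % 2 ≡ 0) →
      Σ Seq λ t → Σ Seq λ t′ →
        InDInv s t × InDInv s t′ ×
        (∀ u → InDInv s u → (u ≈ t) ⊎ (u ≈ t′)) ×
        Orientable (ℕ.suc n) m t × Orientable (ℕ.suc n) m t′ ×
        ODisjoint (ℕ.suc n) t t′ ×
        Primitive (ℕ.suc n) m t × Primitive (ℕ.suc n) m t′ ×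
        (t′ ≈ complement t))
    ×
    ((weight m s % 2 ≡ 1) →
      Σ Seq λ t → Σ ℕ λ k → Σ ℕ λ k′ →
        InDInv s (shift k t) × InDInv s (shift k′ t) ×
        (∀ u → InDInv s u → (u ≈ shift k t) ⊎ (u ≈ shift k′ t)) ×
        ¬ (shift k t ≈ shift k′ t) ×
        Orientable (ℕ.suc n) (2 * m) t ×
        (weight (2 * m) t ≡ m))
-- 1 ≤ n is implied: nothing is orientable of order 0, as empty windows are their own reverses.
theorem4 n m _ s orient@(((s-period@(m>0 , _) , _) , _) , _) =
  (λ even → let per = integrate-periodic s-period even; per̄ = complement-periodic per in
    t , complement t , ((m , per) , Dt) , ((m , per̄) , Dt̄) , fibre ,
    periodic-lift-orientable t Dt per , periodic-lift-orientable (complement t) Dt̄ per̄ ,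
    (periodic-lift-disjoint t Dt per , λ i j → lift-reverse t (complement t) i j Dt Dt̄) ,
    periodic-lift-primitive t Dt per , periodic-lift-primitive (complement t) Dt̄ per̄ ,
    λ _ → refl) ,
  (λ odd → let anti = integrate-antiperiodic s-period odd; per₂ = antiperiodic⇒periodic m>0 anti
               shift≈t̄ = antiperiodic-shift anti in
    t , 0 , m , ((2 * m , per₂) , Dt) ,
    ((2 * m , shift-periodic m per₂) , λ i → trans (D-cong shift≈t̄ i) (Dt̄ i)) ,
    (λ u u∈D⁻¹s → map₂ (λ u≈t̄ i → trans (u≈t̄ i) (sym (shift≈t̄ i))) (fibre u u∈D⁻¹s)) ,
    (λ t≈shift → not-¬ refl (trans (t≈shift 0) (shift≈t̄ 0))) ,
    antiperiodic-lift-orientable t Dt anti , weight-antiperiodic anti)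
  where
  open Lift orient

  t : Seq
  t = integrate s

  Dt : D t ≈ s
  Dt = D-integrate s

  Dt̄ : D (complement t) ≈ s
  Dt̄ = D-complement-integrate s

  fibre : ∀ u → InDInv s u → u ≈ t ⊎ u ≈ complement t
  fibre u (_ , Du) = integrate-fibre Du
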